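{- Let $d\le n$ be positive integers. If there exists a symmetric diagonal Kotzig array of order $d\times n$, then there exists an SFD$(d,n)$.
   Context: For an integer $a$ and a positive integer $n$, $\langle a\rangle_n$ denotes the unique element of $\{1,\dots,n\}$ congruent to $a$ modulo $n$. For a $d\times n$ array $A=(a_{i,j})$ ($i\in\{1,\dots,d\}$, $j\in\{1,\dots,n\}$), the forward diagonals are, for each $j\in\{1,\dots,n\}$, the sets of entries $\{a_{i,\langle j+i\rangle_n}: i=1,\dots,d\}$. A $d\times n$ array $A=(a_{i,j})$ with $d\le n$ is a symmetric diagonal Kotzig array if: (1) each row is a permutation of $\{1,\dots,n\}$; (2) all columns have the same sum; (3) all forward diagonals have the same sum; (4) $a_{i,j}+a_{d+1-i,n+1-j}=n+1$ for all $i,j$. A $t\times n$ array $A=(a_{i,j})$ with $t\le n$ is a symmetric forward diagonals array, SFD$(t,n)$, if: (1) its entries are $nt$ consecutive positive integers (each occurring once); (2) all columns have the same sum; (3) all forward diagonals have the same sum; (4) $a_{i,j}+a_{t+1-i,n+1-j}$ is a constant independent of $(i,j)$. -}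

module Defs where

open import Data.Nat using (ℕ; zero; suc; _+_; _*_; _∸_; _≤_; _<_; NonZero)
open import Data.Nat.DivMod using (_%_)
open import Data.Fin using (Fin; toℕ; opposite; fromℕ<) renaming (zero to fzero; suc to fsuc)
open import Data.Nat.DivMod using (m%n<n)
open import Data.Product using (_×_; Σ; ∃; _,_)
open import Relation.Binary.PropositionalEquality using (_≡_)

-- A d × n array, 0-based indices: row i : Fin d, column j : Fin n.
-- (Paper's 1-based index i corresponds to toℕ i + 1.)
Array : ℕ → ℕ → Set
Array d n = Fin d → Fin n → ℕ

sumFin : (k : ℕ) → (Fin k → ℕ) → ℕ
sumFin zero    f = 0
sumFin (suc k) f = f fzero + sumFin k (λ x → f (fsuc x))

colSum : ∀ {d n} → Array d n → Fin n → ℕ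
colSum {d} A j = sumFin d (λ i → A i j)

-- Column index (0-based) of the entry in row i of forward diagonal j.
-- Paper (1-based): column <j+i>_n.  0-based: (j' + i' + 1) mod n.
diagCol : ∀ {d n} .{{_ : NonZero n}} → Fin n → Fin d → Fin n
diagCol {d} {n} j i = fromℕ< (m%n<n (toℕ j + toℕ i + 1) n)

diagSum : ∀ {d n} .{{_ : NonZero n}} → Array d n → Fin n → ℕ
diagSum {d} A j = sumFin d (λ i → A i (diagCol j i))

EqualColumnSums : ∀ {d n} → Array d n → Set
EqualColumnSums {d} {n} A = ∀ (j j′ : Fin n) → colSum A j ≡ colSum A j′

EqualDiagonalSums : ∀ {d n} .{{_ : NonZero n}} → Array d n → Set
EqualDiagonalSums {d} {n} A = ∀ (j j′ : Fin n) → diagSum A j ≡ diagSum A j′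

RowsArePermutations : ∀ {d n} → Array d n → Set
RowsArePermutations {d} {n} A =
  ∀ (i : Fin d) →
    (∀ (j : Fin n) → 1 ≤ A i j × A i j ≤ n) ×
    (∀ (j j′ : Fin n) → A i j ≡ A i j′ → j ≡ j′)

record IsSymDiagKotzig (d n : ℕ) .{{_ : NonZero n}} (A : Array d n) : Set where
  field
    d≤n       : d ≤ n
    rowsPerm  : RowsArePermutations A
    colsEq    : EqualColumnSums A
    diagsEq   : EqualDiagonalSums A
    symmetric : ∀ (i : Fin d) (j : Fin n) →
                  A i j + A (opposite i) (opposite j) ≡ n + 1

record IsSFD (t n : ℕ) .{{_ : NonZero n}} (A : Array t n) : Set where
  field
    t≤n        : t ≤ n
    start      : ℕ
    start-pos  : 1 ≤ start
    inRange    : ∀ (i : Fin t) (j : Fin n) → start ≤ A i j × A i j < start + n * t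
    injective  : ∀ (i i′ : Fin t) (j j′ : Fin n) →
                   A i j ≡ A i′ j′ → (i ≡ i′ × j ≡ j′)
    colsEq     : EqualColumnSums A
    diagsEq    : EqualDiagonalSums A
    symConst   : ℕ
    symmetric  : ∀ (i : Fin t) (j : Fin n) →
                   A i j + A (opposite i) (opposite j) ≡ symConst

-- Stack the rows of a symmetric diagonal Kotzig array A into disjoint blocks:
-- B i j = n·i + A i j (rows indexed from 0).  Row i of B is a permutation of
-- {n·i + 1, …, n·i + n}, so B uses 1, …, nd exactly once.  The added offset
-- depends only on the row, so it adds the same amount to every column and to
-- every forward diagonal, and since i + (d − 1 − i) is constant the symmetry
-- A i j + A i' j' = n + 1 becomes B i j + B i' j' = nd + 1.
module Submission where

open import Defs
open import Data.Nat using (ℕ; _≤_; NonZero)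
open import Data.Product using (Σ)

open import Data.Nat using (zero; suc; _+_; _*_; _<_; s≤s)
open import Data.Nat.Properties
open import Data.Nat.Solver using (module +-*-Solver)
open import Data.Fin using (Fin; toℕ; opposite) renaming (zero to fzero; suc to fsuc)
open import Data.Fin.Properties using (toℕ-injective; opposite-prop; toℕ<n)
open import Data.Product using (_,_; _×_; proj₁; proj₂)
open import Relation.Binary using (tri<; tri≈; tri>)
open import Relation.Binary.PropositionalEquality
open import Relation.Nullary using (contradiction)

open +-*-Solver

sumFin-+ : ∀ k (f g : Fin k → ℕ) →
           sumFin k (λ i → f i + g i) ≡ sumFin k f + sumFin k g
sumFin-+ zero    f g = refl
sumFin-+ (suc k) f g
  rewrite sumFin-+ k (λ x → f (fsuc x)) (λ x → g (fsuc x)) =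
  solve 4 (λ a b c e → (a :+ b) :+ (c :+ e) := (a :+ c) :+ (b :+ e)) refl
    (f fzero) (g fzero) (sumFin k (λ x → f (fsuc x))) (sumFin k (λ x → g (fsuc x)))

sumFin-cong-+ˡ : ∀ k (h f g : Fin k → ℕ) → sumFin k f ≡ sumFin k g →
                 sumFin k (λ i → h i + f i) ≡ sumFin k (λ i → h i + g i)
sumFin-cong-+ˡ k h f g eq = begin
  sumFin k (λ i → h i + f i) ≡⟨ sumFin-+ k h f ⟩
  sumFin k h + sumFin k f    ≡⟨ cong (sumFin k h +_) eq ⟩
  sumFin k h + sumFin k g    ≡⟨ sym (sumFin-+ k h g) ⟩
  sumFin k (λ i → h i + g i) ∎
  where open ≡-Reasoning

toℕ-+-toℕ-opposite : ∀ {d} (i : Fin d) → suc (toℕ i) + toℕ (opposite i) ≡ d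
toℕ-+-toℕ-opposite i =
  trans (cong (suc (toℕ i) +_) (opposite-prop i)) (m+[n∸m]≡n (toℕ<n i))

*+-≤-*-suc : ∀ n q {r} → r ≤ n → n * q + r ≤ n * suc q
*+-≤-*-suc n q {r} r≤n = begin
  n * q + r ≤⟨ +-monoʳ-≤ (n * q) r≤n ⟩
  n * q + n ≡⟨ +-comm (n * q) n ⟩
  n + n * q ≡⟨ *-suc n q ⟨
  n * suc q ∎
  where open ≤-Reasoning

*+-<-*+ : ∀ n {q q′ r r′} → q < q′ → r ≤ n → 1 ≤ r′ → n * q + r < n * q′ + r′
*+-<-*+ n {q} {q′} {r} {r′} q<q′ r≤n 1≤r′ = begin-strict
  n * q + r    ≤⟨ *+-≤-*-suc n q r≤n ⟩
  n * suc q    ≤⟨ *-monoʳ-≤ n q<q′ ⟩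
  n * q′       <⟨ m<m+n (n * q′) 1≤r′ ⟩
  n * q′ + r′  ∎
  where open ≤-Reasoning

*+-injectiveˡ : ∀ n {q q′ r r′} → 1 ≤ r → r ≤ n → 1 ≤ r′ → r′ ≤ n →
                n * q + r ≡ n * q′ + r′ → q ≡ q′
*+-injectiveˡ n {q} {q′} 1≤r r≤n 1≤r′ r′≤n eq with <-cmp q q′
... | tri< q<q′ _ _ = contradiction eq (<⇒≢ (*+-<-*+ n q<q′ r≤n 1≤r′))
... | tri≈ _ q≡q′ _ = q≡q′
... | tri> _ _ q′<q = contradiction (sym eq) (<⇒≢ (*+-<-*+ n q′<q r′≤n 1≤r))

stackRows : ∀ {d n} → Array d n → Array d n
stackRows {n = n} A i j = n * toℕ i + A i j

stackRows-colsEq : ∀ {d n} (A : Array d n) →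
                   EqualColumnSums A → EqualColumnSums (stackRows A)
stackRows-colsEq {d} {n} A colsEq j j′ =
  sumFin-cong-+ˡ d (λ i → n * toℕ i) (λ i → A i j) (λ i → A i j′) (colsEq j j′)

stackRows-diagsEq : ∀ {d n} .{{_ : NonZero n}} (A : Array d n) →
                    EqualDiagonalSums A → EqualDiagonalSums (stackRows A)
stackRows-diagsEq {d} {n} A diagsEq j j′ =
  sumFin-cong-+ˡ d (λ i → n * toℕ i)
    (λ i → A i (diagCol j i)) (λ i → A i (diagCol j′ i)) (diagsEq j j′)

module _ {d n : ℕ} {A : Array d n} (rowsPerm : RowsArePermutations A) where

  private
    1≤A : ∀ i j → 1 ≤ A i j
    1≤A i j = proj₁ (proj₁ (rowsPerm i) j)

    A≤n : ∀ i j → A i j ≤ n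
    A≤n i j = proj₂ (proj₁ (rowsPerm i) j)

  stackRows-inRange : ∀ i j → 1 ≤ stackRows A i j × stackRows A i j < 1 + n * d
  stackRows-inRange i j =
    ≤-trans (1≤A i j) (m≤n+m (A i j) (n * toℕ i)) ,
    s≤s (≤-trans (*+-≤-*-suc n (toℕ i) (A≤n i j)) (*-monoʳ-≤ n (toℕ<n i)))

  stackRows-injective : ∀ i i′ j j′ →
                        stackRows A i j ≡ stackRows A i′ j′ → i ≡ i′ × j ≡ j′
  stackRows-injective i i′ j j′ eq
    with toℕ-injective (*+-injectiveˡ n (1≤A i j) (A≤n i j) (1≤A i′ j′) (A≤n i′ j′) eq)
  ... | refl = refl , proj₂ (rowsPerm i) j j′ (+-cancelˡ-≡ (n * toℕ i) _ _ eq)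

stackRows-symmetric : ∀ {d n} {A : Array d n} →
  (∀ i j → A i j + A (opposite i) (opposite j) ≡ n + 1) →
  ∀ i j → stackRows A i j + stackRows A (opposite i) (opposite j) ≡ n * d + 1
stackRows-symmetric {d} {n} {A} symmetric i j = begin
  n * q + A i j + (n * q′ + A (opposite i) (opposite j))
    ≡⟨ solve 4 (λ x a y b → (x :+ a) :+ (y :+ b) := (x :+ y) :+ (a :+ b)) refl
         (n * q) (A i j) (n * q′) (A (opposite i) (opposite j)) ⟩
  n * q + n * q′ + (A i j + A (opposite i) (opposite j))
    ≡⟨ cong (n * q + n * q′ +_) (symmetric i j) ⟩
  n * q + n * q′ + (n + 1)
    ≡⟨ solve 3 (λ n q q′ → n :* q :+ n :* q′ :+ (n :+ con 1)
                         := n :* (con 1 :+ q :+ q′) :+ con 1) refl n q q′ ⟩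
  n * (suc q + q′) + 1
    ≡⟨ cong (λ m → n * m + 1) (toℕ-+-toℕ-opposite i) ⟩
  n * d + 1 ∎
  where
  open ≡-Reasoning
  q = toℕ i
  q′ = toℕ (opposite i)

stackRows-isSFD : ∀ {d n} .{{_ : NonZero n}} {A : Array d n} →
                  IsSymDiagKotzig d n A → IsSFD d n (stackRows A)
stackRows-isSFD {d} {n} {A} K = record
  { t≤n       = d≤n
  ; start     = 1
  ; start-pos = ≤-refl
  ; inRange   = stackRows-inRange rowsPerm
  ; injective = stackRows-injective rowsPerm
  ; colsEq    = stackRows-colsEq A colsEq
  ; diagsEq   = stackRows-diagsEq A diagsEq
  ; symConst  = n * d + 1
  ; symmetric = stackRows-symmetric symmetric
  }
  where open IsSymDiagKotzig K

mainTheorem3 : ∀ (d n : ℕ) .{{_ : NonZero n}} → 1 ≤ d → d ≤ n →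
    Σ (Array d n) (λ A → IsSymDiagKotzig d n A) →
    Σ (Array d n) (λ B → IsSFD d n B)
mainTheorem3 d n _ _ (A , K) = stackRows A , stackRows-isSFD K
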